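{- Let $n\ge1$, let $L_n$ be the lattice of arithmetic progressions in $[n]$, and let $A_n\subseteq L_n$ be the set of coatoms of $L_n$. If $x\in L_n$ can be expressed as $x=\bigwedge_{s\in S}s$ for some $S\subseteq A_n$, then $S$ is uniquely determined by $x$.
   Context: $L_n$ is the set of all subsets of $[n]=\{1,\ldots,n\}$ that are arithmetic progressions $\{a,a+r,\ldots,a+(k-1)r\}$ ($a$, $r\ge1$, $k\ge0$ integers; including $\emptyset$, singletons and $2$-element subsets), ordered by inclusion; it is a lattice with minimum $\emptyset$, maximum $[n]$, and meet $\wedge$ equal to intersection. Coatoms are the elements covered by $[n]$. -}

module Defs where

open import Data.Nat using (ℕ; suc; _+_; _*_; _≤_; _<_)
open import Data.Fin using (Fin; toℕ)
open import Data.Fin.Subset using (Subset; _∈_; _⊂_; ⊤)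
open import Data.Bool using (Bool; true)
open import Data.Product using (Σ; ∃; _×_)
open import Data.Empty using (⊥)
open import Function.Bundles using (_⇔_)
open import Relation.Binary.PropositionalEquality using (_≡_)

-- A subset p of [n] = {1,…,n} is encoded as a Subset n (Fin n ↦ inside/outside),
-- where j : Fin n stands for the number toℕ j + 1.

IsAP : {n : ℕ} → Subset n → Set
IsAP {n} p =
  ∃ λ a → ∃ λ r → ∃ λ k →
    (1 ≤ a) × (1 ≤ r) ×
    (∀ i → i < k → a + i * r ≤ n) ×
    (∀ (j : Fin n) → (j ∈ p) ⇔ (∃ λ i → (i < k) × (suc (toℕ j) ≡ a + i * r)))

-- Elements of L_n are the Subsets satisfying IsAP; order is inclusion.
-- Coatom of L_n: an element x < [n] with no element of L_n strictly between x and [n].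
IsCoatom : {n : ℕ} → Subset n → Set
IsCoatom {n} x =
  IsAP x × (x ⊂ ⊤) × (∀ (y : Subset n) → IsAP y → x ⊂ y → y ⊂ ⊤ → ⊥)

-- A family S of elements of L_n is a decidable set of subsets, given by its
-- characteristic function.  x is the meet (= intersection, with the empty meet
-- being [n]) of S.
IsMeetOf : {n : ℕ} → Subset n → (Subset n → Bool) → Set
IsMeetOf {n} x S =
  ∀ (j : Fin n) → (j ∈ x) ⇔ (∀ (s : Subset n) → S s ≡ true → j ∈ s)

-- Every coatom c has a private witness: a point j ∉ c that lies in every other coatom. So if c
-- belongs to S but not to T, then j lies in every member of T, hence in the meet x, hence in c.
-- In 1-based numbering every coatom is {2,…,n}, {1,…,n−1} (witnesses 1 and n) or a progression
-- {1, 1+p, 1+2p, …, n} with p ≥ 2. For the latter take j = 1 + m, where m is n − 1 with all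
-- factors p removed: a progression {1, 1+q, …, n} misses j only if gcd(p,q) > 1, and then both
-- coatoms lie below the proper progression of step gcd(p,q), so they coincide.
module Submission where

open import Defs
open import Data.Nat using (ℕ; zero; suc; _+_; _*_; _≤_; _<_; z≤n; s≤s; _≤?_; _<?_; >-nonZero)
open import Data.Nat.Properties
open import Data.Nat.Divisibility using (_∣_; divides; _∣?_; ∣-trans; ∣1⇒≡1; 1∣_)
open import Data.Nat.GCD using (gcd; gcd[m,n]∣m; gcd[m,n]∣n; gcd[m,n]≢0)
open import Data.Nat.Coprimality using (Coprime; coprime?; coprime-divisor; gcd≡1⇒coprime)
open import Data.Nat.Induction using (<-rec)
open import Data.Fin using (Fin; toℕ; fromℕ; fromℕ<) renaming (zero to fzero; suc to fsuc)
open import Data.Fin.Properties using (toℕ-fromℕ; toℕ-fromℕ<; toℕ<n; toℕ-injective)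
open import Data.Fin.Subset using (Subset; _∈_; _∉_; _⊆_; ⊤)
open import Data.Fin.Subset.Properties using (_∈?_; ∈⊤; ⊆-antisym)
open import Data.Vec using (tabulate)
open import Data.Vec.Properties using (lookup∘tabulate; []=⇒lookup; lookup⇒[]=)
open import Data.Bool using (Bool; true; false)
open import Data.Bool.Properties using (⇔→≡)
open import Data.Product using (∃; _×_; _,_)
open import Data.Sum using (inj₂)
open import Data.Empty using (⊥-elim)
open import Function.Bundles using (_⇔_; mk⇔; Equivalence)
open import Relation.Binary.PropositionalEquality using (_≡_; _≢_; refl; sym; trans; cong; subst; subst₂)
open import Level using (0ℓ)
open import Relation.Nullary using (¬_; yes; no; does)
open import Relation.Nullary.Decidable using (dec-true)
open import Relation.Unary using (Pred; Decidable)

open Equivalence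

subsetOf : ∀ {n} {P : Pred (Fin n) 0ℓ} → Decidable P → Subset n
subsetOf P? = tabulate (λ t → does (P? t))

∈-subsetOf : ∀ {n} {P : Pred (Fin n) 0ℓ} (P? : Decidable P) {t} → t ∈ subsetOf P? ⇔ P t
∈-subsetOf {P = P} P? {t} =
  mk⇔ member (λ Pt → lookup⇒[]= t _ (trans (lookup∘tabulate _ t) (dec-true (P? t) Pt)))
  where
  member : t ∈ subsetOf P? → P t
  member t∈ with P? t | trans (sym (lookup∘tabulate (λ t → does (P? t)) t)) ([]=⇒lookup t∈)
  ... | yes Pt | _ = Pt
  ... | no _   | ()

withoutFirst : (N : ℕ) → Subset (suc N)
withoutFirst N = subsetOf (λ t → 1 ≤? toℕ t)

withoutLast : (N : ℕ) → Subset (suc N)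
withoutLast N = subsetOf (λ t → toℕ t <? N)

-- Positions count from 0, so this is the progression {1, 1+g, 1+2g, …} of [N+1].
multiples : (N g : ℕ) → Subset (suc N)
multiples N g = subsetOf (λ t → g ∣? toℕ t)

∈-withoutFirst : ∀ {N t} → t ∈ withoutFirst N ⇔ 1 ≤ toℕ t
∈-withoutFirst = ∈-subsetOf (λ t → 1 ≤? toℕ t)

∈-withoutLast : ∀ {N t} → t ∈ withoutLast N ⇔ toℕ t < N
∈-withoutLast {N} = ∈-subsetOf (λ t → toℕ t <? N)

∈-multiples : ∀ {N g t} → t ∈ multiples N g ⇔ g ∣ toℕ t
∈-multiples {g = g} = ∈-subsetOf (λ t → g ∣? toℕ t)

withoutFirst-isAP : ∀ N → IsAP (withoutFirst N)
withoutFirst-isAP N = 2 , 1 , N , s≤s z≤n , s≤s z≤n , inBounds , λ t → mk⇔ (index t) member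
  where
  inBounds : ∀ i → i < N → 2 + i * 1 ≤ suc N
  inBounds i i<N rewrite *-identityʳ i = s≤s i<N
  index : ∀ t → t ∈ withoutFirst N → ∃ λ i → i < N × suc (toℕ t) ≡ 2 + i * 1
  index t t∈ with toℕ t | ∈-withoutFirst .to t∈ | toℕ<n t
  ... | zero  | ()  | _
  ... | suc i | _   | s≤s i<N = i , i<N , cong (2 +_) (sym (*-identityʳ i))
  member : ∀ {t} → (∃ λ i → i < N × suc (toℕ t) ≡ 2 + i * 1) → t ∈ withoutFirst N
  member (i , _ , eq) = ∈-withoutFirst .from (subst (1 ≤_) (sym (suc-injective eq)) (s≤s z≤n))

withoutLast-isAP : ∀ N → IsAP (withoutLast N)
withoutLast-isAP N = 1 , 1 , N , s≤s z≤n , s≤s z≤n , inBounds , λ t → mk⇔ (index t) member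
  where
  inBounds : ∀ i → i < N → 1 + i * 1 ≤ suc N
  inBounds i i<N rewrite *-identityʳ i = s≤s (<⇒≤ i<N)
  index : ∀ t → t ∈ withoutLast N → ∃ λ i → i < N × suc (toℕ t) ≡ 1 + i * 1
  index t t∈ = toℕ t , ∈-withoutLast .to t∈ , cong suc (sym (*-identityʳ (toℕ t)))
  member : ∀ {t} → (∃ λ i → i < N × suc (toℕ t) ≡ 1 + i * 1) → t ∈ withoutLast N
  member (i , i<N , eq) =
    ∈-withoutLast .from (subst (_< N) (sym (trans (suc-injective eq) (*-identityʳ i))) i<N)

multiples-isAP : ∀ N g → 1 ≤ g → g ∣ N → IsAP (multiples N g)
multiples-isAP N g@(suc _) _ (divides q N≡qg) =
  1 , g , suc q , s≤s z≤n , s≤s z≤n , inBounds , λ t → mk⇔ (index t) member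
  where
  inBounds : ∀ i → i < suc q → 1 + i * g ≤ suc N
  inBounds i (s≤s i≤q) = s≤s (subst (i * g ≤_) (sym N≡qg) (*-monoˡ-≤ g i≤q))
  index : ∀ t → t ∈ multiples N g → ∃ λ i → i < suc q × suc (toℕ t) ≡ 1 + i * g
  index t t∈ with ∈-multiples .to t∈
  ... | divides i t≡ig = i , s≤s (*-cancelʳ-≤ i q g ig≤qg) , cong suc t≡ig
    where
    ig≤qg : i * g ≤ q * g
    ig≤qg = subst₂ _≤_ t≡ig N≡qg (≤-pred (toℕ<n t))
  member : ∀ {t} → (∃ λ i → i < suc q × suc (toℕ t) ≡ 1 + i * g) → t ∈ multiples N g
  member (i , _ , eq) = ∈-multiples .from (divides i (suc-injective eq))

multiples-⊆ : ∀ {N g p} → g ∣ p → multiples N p ⊆ multiples N g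
multiples-⊆ g∣p t∈ = ∈-multiples .from (∣-trans g∣p (∈-multiples .to t∈))

first∉withoutFirst : ∀ N → fzero ∉ withoutFirst N
first∉withoutFirst N 0∈ with ∈-withoutFirst .to 0∈
... | ()

last∉withoutLast : ∀ N → fromℕ N ∉ withoutLast N
last∉withoutLast N N∈ = n≮n N (subst (_< N) (toℕ-fromℕ N) (∈-withoutLast .to N∈))

second∉multiples : ∀ {N g} → 2 ≤ g → fsuc fzero ∉ multiples (suc N) g
second∉multiples {N} {g} (s≤s (s≤s _)) 1∈ with ∣1⇒≡1 (∈-multiples {suc N} {g} .to 1∈)
... | ()

coatom-⊆⇒≡ : ∀ {n} {c y : Subset n} {z} → IsCoatom c → IsAP y → c ⊆ y → z ∉ y → c ≡ y
coatom-⊆⇒≡ {c = c} {y} {z} (_ , _ , maximal) y-isAP c⊆y z∉y = ⊆-antisym c⊆y y⊆c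
  where
  y⊆c : y ⊆ c
  y⊆c {t} t∈y with t ∈? c
  ... | yes t∈c = t∈c
  ... | no t∉c = ⊥-elim (maximal y y-isAP (c⊆y , t , t∈y , t∉c) ((λ _ → ∈⊤) , z , ∈⊤ , z∉y))

coatom-∌first : ∀ {N} {c : Subset (suc N)} → IsCoatom c → fzero ∉ c → c ≡ withoutFirst N
coatom-∌first {N} {c} c-coatom 0∉c =
  coatom-⊆⇒≡ c-coatom (withoutFirst-isAP N) c⊆ (first∉withoutFirst N)
  where
  c⊆ : c ⊆ withoutFirst N
  c⊆ {fzero}  0∈c = ⊥-elim (0∉c 0∈c)
  c⊆ {fsuc _} _   = ∈-withoutFirst .from (s≤s z≤n)

coatom-∌last : ∀ {N} {c : Subset (suc N)} → IsCoatom c → fromℕ N ∉ c → c ≡ withoutLast N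
coatom-∌last {N} {c} c-coatom N∉c =
  coatom-⊆⇒≡ c-coatom (withoutLast-isAP N) c⊆ (last∉withoutLast N)
  where
  c⊆ : c ⊆ withoutLast N
  c⊆ {t} t∈c = ∈-withoutLast .from (≤∧≢⇒< (≤-pred (toℕ<n t)) t≢N)
    where
    t≢N : toℕ t ≢ N
    t≢N t≡N = N∉c (subst (_∈ c) (toℕ-injective (trans t≡N (sym (toℕ-fromℕ N)))) t∈c)

AP-∋ends : ∀ {N} {c : Subset (suc N)} → IsAP c → fzero ∈ c → fromℕ N ∈ c →
           ∃ λ r → 1 ≤ r × r ∣ N × c ≡ multiples N r
AP-∋ends {N} {c} (suc a , r , k , _ , 1≤r , _ , mem) 0∈c N∈c
  with mem fzero .to 0∈c | mem (fromℕ N) .to N∈c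
... | i₀ , _ , 1≡1+a+i₀r | i₁ , i₁<k , N+1≡1+a+i₁r
  with m+n≡0⇒m≡0 a (sym (suc-injective 1≡1+a+i₀r))
... | refl = r , 1≤r , divides i₁ N≡i₁r , ⊆-antisym c⊆ ⊆c
  where
  N≡i₁r : N ≡ i₁ * r
  N≡i₁r = trans (sym (toℕ-fromℕ N)) (suc-injective N+1≡1+a+i₁r)
  c⊆ : c ⊆ multiples N r
  c⊆ {t} t∈c with mem t .to t∈c
  ... | i , _ , eq = ∈-multiples .from (divides i (suc-injective eq))
  ⊆c : multiples N r ⊆ c
  ⊆c {t} t∈ with ∈-multiples .to t∈
  ... | divides i t≡ir = mem t .from (i , ≤-<-trans i≤i₁ i₁<k , cong suc t≡ir)
    where
    i≤i₁ : i ≤ i₁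
    i≤i₁ = *-cancelʳ-≤ i i₁ r {{>-nonZero 1≤r}} (subst₂ _≤_ t≡ir N≡i₁r (≤-pred (toℕ<n t)))

fzero∈∧∉⇒1≤N : ∀ {N} {c : Subset (suc N)} {z} → fzero ∈ c → z ∉ c → 1 ≤ N
fzero∈∧∉⇒1≤N {zero}  {z = fzero} 0∈c 0∉c = ⊥-elim (0∉c 0∈c)
fzero∈∧∉⇒1≤N {suc _} _ _ = s≤s z≤n

coatom-∋ends : ∀ {N} {c : Subset (suc N)} → IsCoatom c → fzero ∈ c → fromℕ N ∈ c →
               1 ≤ N × ∃ λ p → 2 ≤ p × p ∣ N × c ≡ multiples N p
coatom-∋ends (c-isAP , (_ , z , _ , z∉c) , _) 0∈c N∈c with AP-∋ends c-isAP 0∈c N∈c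
... | r , 1≤r , r∣N , refl = fzero∈∧∉⇒1≤N 0∈c z∉c , r , 2≤r , r∣N , refl
  where
  2≤r : 2 ≤ r
  2≤r = ≤∧≢⇒< 1≤r (λ 1≡r → z∉c (∈-multiples .from (subst (_∣ toℕ z) 1≡r (1∣ toℕ z))))

PFreePart : ℕ → ℕ → ℕ → Set
PFreePart p m j = 1 ≤ j × j ≤ m × ¬ p ∣ j × (∀ {q} → Coprime q p → q ∣ m → q ∣ j)

PFreePart-*ʳ : ∀ {p k j} → 1 ≤ p → PFreePart p k j → PFreePart p (k * p) j
PFreePart-*ʳ {p} {k} 1≤p (1≤j , j≤k , p∤j , coprime∣j) =
  1≤j , ≤-trans j≤k (m≤m*n k p {{>-nonZero 1≤p}}) , p∤j ,
  λ {q} q⊥p q∣kp → coprime∣j q⊥p (coprime-divisor q⊥p (subst (q ∣_) (*-comm k p) q∣kp))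

p-freePart : ∀ {p} → 2 ≤ p → ∀ m → 1 ≤ m → ∃ (PFreePart p m)
p-freePart {p} 2≤p = <-rec _ freePart
  where
  freePart : ∀ m → (∀ {k} → k < m → 1 ≤ k → ∃ (PFreePart p k)) → 1 ≤ m → ∃ (PFreePart p m)
  freePart m rec 1≤m with p ∣? m
  ... | no p∤m = m , 1≤m , ≤-refl , p∤m , λ _ q∣m → q∣m
  ... | yes (divides zero m≡0) = ⊥-elim (<⇒≢ 1≤m (sym m≡0))
  ... | yes (divides k@(suc _) refl) with rec (m<m*n k p 2≤p) (s≤s z≤n)
  ...   | j , j-free = j , PFreePart-*ʳ (<⇒≤ 2≤p) j-free

¬coprime⇒2≤gcd : ∀ {q p} → 1 ≤ p → ¬ Coprime q p → 2 ≤ gcd q p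
¬coprime⇒2≤gcd {q} {p} 1≤p q⊥̸p with gcd q p in gcd≡
... | zero        = ⊥-elim (gcd[m,n]≢0 q p (inj₂ (m<n⇒n≢0 1≤p)) gcd≡)
... | suc zero    = ⊥-elim (q⊥̸p (gcd≡1⇒coprime gcd≡))
... | suc (suc _) = s≤s (s≤s z≤n)

multiples-coatoms-≡ : ∀ {N p q} → 1 ≤ p → p ∣ suc N → ¬ Coprime q p →
                      IsCoatom (multiples (suc N) p) → IsCoatom (multiples (suc N) q) →
                      multiples (suc N) q ≡ multiples (suc N) p
multiples-coatoms-≡ {N} {p} {q} 1≤p p∣N q⊥̸p p-coatom q-coatom =
  trans (below q-coatom (gcd[m,n]∣m q p)) (sym (below p-coatom (gcd[m,n]∣n q p)))
  where
  g : ℕ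
  g = gcd q p
  2≤g : 2 ≤ g
  2≤g = ¬coprime⇒2≤gcd 1≤p q⊥̸p
  g-isAP : IsAP (multiples (suc N) g)
  g-isAP = multiples-isAP (suc N) g (<⇒≤ 2≤g) (∣-trans (gcd[m,n]∣n q p) p∣N)
  below : ∀ {r} → IsCoatom (multiples (suc N) r) → g ∣ r → multiples (suc N) r ≡ multiples (suc N) g
  below r-coatom g∣r = coatom-⊆⇒≡ r-coatom g-isAP (multiples-⊆ g∣r) (second∉multiples 2≤g)

IsPrivateWitness : ∀ {n} → Subset n → Fin n → Set
IsPrivateWitness {n} c j = j ∉ c × (∀ (d : Subset n) → IsCoatom d → j ∉ d → d ≡ c)

multiples-privateWitness : ∀ {N p} → 1 ≤ N → 2 ≤ p → p ∣ N → IsCoatom (multiples N p) →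
                           ∃ (IsPrivateWitness (multiples N p))
multiples-privateWitness {N@(suc _)} {p} (s≤s z≤n) 2≤p p∣N p-coatom
  with p-freePart 2≤p N (s≤s z≤n)
... | j , 1≤j , j≤N , p∤j , coprime∣j = position , position∉ , unique
  where
  j<N : j < N
  j<N = ≤∧≢⇒< j≤N (λ j≡N → p∤j (subst (p ∣_) (sym j≡N) p∣N))
  position : Fin (suc N)
  position = fromℕ< (m<n⇒m<1+n j<N)
  toℕ-position : toℕ position ≡ j
  toℕ-position = toℕ-fromℕ< (m<n⇒m<1+n j<N)
  position∉ : position ∉ multiples N p
  position∉ p∣ = p∤j (subst (p ∣_) toℕ-position (∈-multiples .to p∣))
  unique : ∀ d → IsCoatom d → position ∉ d → d ≡ multiples N p
  unique d d-coatom pos∉d with fzero ∈? d | fromℕ N ∈? d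
  ... | no 0∉d | _ = ⊥-elim (pos∉d (subst (position ∈_) (sym (coatom-∌first d-coatom 0∉d))
                          (∈-withoutFirst .from (subst (1 ≤_) (sym toℕ-position) 1≤j))))
  ... | yes _ | no N∉d = ⊥-elim (pos∉d (subst (position ∈_) (sym (coatom-∌last d-coatom N∉d))
                          (∈-withoutLast .from (subst (_< N) (sym toℕ-position) j<N))))
  ... | yes 0∈d | yes N∈d with coatom-∋ends d-coatom 0∈d N∈d
  ...   | _ , q , _ , q∣N , refl with coprime? q p
  ...     | yes q⊥p =
            ⊥-elim (pos∉d (∈-multiples .from (subst (q ∣_) (sym toℕ-position) (coprime∣j q⊥p q∣N))))
  ...     | no q⊥̸p = multiples-coatoms-≡ (<⇒≤ 2≤p) p∣N q⊥̸p p-coatom d-coatom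

coatom-privateWitness : ∀ {N} (c : Subset (suc N)) → IsCoatom c → ∃ (IsPrivateWitness c)
coatom-privateWitness {N} c c-coatom with fzero ∈? c | fromℕ N ∈? c
... | no 0∉c | _ = fzero , 0∉c ,
  λ d d-coatom 0∉d → trans (coatom-∌first d-coatom 0∉d) (sym (coatom-∌first c-coatom 0∉c))
... | yes _ | no N∉c = fromℕ N , N∉c ,
  λ d d-coatom N∉d → trans (coatom-∌last d-coatom N∉d) (sym (coatom-∌last c-coatom N∉c))
... | yes 0∈c | yes N∈c with coatom-∋ends c-coatom 0∈c N∈c
...   | 1≤N , p , 2≤p , p∣N , refl = multiples-privateWitness 1≤N 2≤p p∣N c-coatom

coatom-meet-family-⊆ : ∀ {N} {x : Subset (suc N)} {S T : Subset (suc N) → Bool} →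
                       (∀ s → S s ≡ true → IsCoatom s) → (∀ t → T t ≡ true → IsCoatom t) →
                       IsMeetOf x S → IsMeetOf x T → ∀ s → S s ≡ true → T s ≡ true
coatom-meet-family-⊆ {x = x} {T = T} S-coatoms T-coatoms x≡⋀S x≡⋀T s s∈S
  with coatom-privateWitness s (S-coatoms s s∈S) | T s in Ts
... | _ | true = refl
... | j , j∉s , unique | false = ⊥-elim (j∉s (x≡⋀S j .to j∈x s s∈S))
  where
  j∈T : ∀ t → T t ≡ true → j ∈ t
  j∈T t t∈T with j ∈? t
  ... | yes j∈t = j∈t
  ... | no j∉t with unique t (T-coatoms t t∈T) j∉t
  ...   | refl with trans (sym Ts) t∈T
  ...     | ()
  j∈x : j ∈ x
  j∈x = x≡⋀T j .from j∈T

lemma6 : (n : ℕ) → 1 ≤ n → (x : Subset n) → IsAP x →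
    (S T : Subset n → Bool) →
    (∀ s → S s ≡ true → IsCoatom s) →
    (∀ s → T s ≡ true → IsCoatom s) →
    IsMeetOf x S → IsMeetOf x T →
    ∀ (s : Subset n) → S s ≡ T s
lemma6 (suc N) _ x _ S T S-coatoms T-coatoms x≡⋀S x≡⋀T s = ⇔→≡ (mk⇔
  (coatom-meet-family-⊆ S-coatoms T-coatoms x≡⋀S x≡⋀T s)
  (coatom-meet-family-⊆ T-coatoms S-coatoms x≡⋀T x≡⋀S s))
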